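{- For every $n\ge1$, there is exactly one binary operation on the chain $C_n$ satisfying (S1), (S2) and (S3), namely $\sigma_n(a,b)=0$ if $a=0$ and $\sigma_n(a,b)=b$ if $a\neq 0$.
   Context: For $n\ge 1$, $C_n=\{0,e,2e,\dots,ne=1\}$ is the effect algebra with partial addition $(ie)\oplus(je)=(i+j)e$ defined (written $ie\perp je$) iff $i+j\le n$, with top $1=ne$. Axioms for a total binary operation $\circ$: (S1) $b\perp c\Rightarrow a\circ(b\oplus c)=(a\circ b)\oplus(a\circ c)$; (S2) $1\circ a=a$; (S3) $a\circ b=0\Rightarrow a\circ b=b\circ a$. -}

module Defs where

open import Data.Nat using (ℕ; suc; _+_; _≤_)
open import Data.Fin using (Fin; toℕ; fromℕ; zero)
import Data.Fin
import Data.Nat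
open import Data.Product using (Σ; _×_)
open import Relation.Binary.PropositionalEquality using (_≡_)
open import Relation.Nullary using (¬_)

-- The chain C_n: the element i·e (0 ≤ i ≤ n) is represented by i : Fin (suc n).
C : ℕ → Set
C n = Fin (suc n)

_⊥[_]_ : {n : ℕ} → C n → (m : ℕ) → C n → Set
a ⊥[ n ] b = toℕ a + toℕ b ≤ n

⊕ : {n : ℕ} → (a b : C n) → toℕ a + toℕ b ≤ n → C n
⊕ {n} a b p = Data.Fin.fromℕ< {toℕ a + toℕ b} {suc n} (Data.Nat.s≤s p)

𝟘 : {n : ℕ} → C n
𝟘 = zero

𝟙 : {n : ℕ} → C n
𝟙 {n} = fromℕ n

S1 : (n : ℕ) → (C n → C n → C n) → Set
S1 n _∘_ = (a b c : C n) (p : toℕ b + toℕ c ≤ n) →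
  Σ (toℕ (a ∘ b) + toℕ (a ∘ c) ≤ n) λ q → a ∘ ⊕ b c p ≡ ⊕ (a ∘ b) (a ∘ c) q

S2 : (n : ℕ) → (C n → C n → C n) → Set
S2 n _∘_ = (a : C n) → 𝟙 ∘ a ≡ a

S3 : (n : ℕ) → (C n → C n → C n) → Set
S3 n _∘_ = (a b : C n) → a ∘ b ≡ 𝟘 → a ∘ b ≡ b ∘ a

IsSOp : (n : ℕ) → (C n → C n → C n) → Set
IsSOp n o = S1 n o × S2 n o × S3 n o

σ : (n : ℕ) → C n → C n → C n
σ n zero b = zero
σ n (Data.Fin.suc a) b = b

{-# OPTIONS --safe #-}
-- By (S1) every left translation b ↦ a ∘ b is additive, so a ∘ (ie) = i (a ∘ e);
-- evaluating at 1 = ne gives n (a ∘ e) ≤ n, hence a ∘ e ∈ {0, e}.  If a ∘ e = 0 then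
-- a ∘ 1 = 0, and (S3), (S2) give a = 1 ∘ a = a ∘ 1 = 0.  So a ∘ b = b whenever a ≠ 0,
-- while 0 ∘ b = b ∘ 0 = 0 by (S3).
module Submission where

open import Defs
open import Data.Nat using (ℕ; zero; suc; _+_; _*_; _≤_; z≤n)
open import Data.Nat.Properties
  using (+-comm; +-identityʳ; +-cancelˡ-≡; *-zeroʳ; *-identityʳ; *-cancelˡ-≤; n≤1⇒n≡0∨n≡1)
open import Data.Fin using (zero; suc; toℕ; inject₁)
open import Data.Fin.Properties
  using (toℕ-injective; toℕ-fromℕ<; toℕ-fromℕ; toℕ-inject₁; toℕ≤pred[n])
open import Data.Fin.Induction using (<-weakInduction)
open import Data.Product using (_×_; _,_; proj₁; proj₂)
open import Data.Sum using (inj₁; inj₂)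
open import Data.Empty using (⊥-elim)
open import Relation.Binary.PropositionalEquality
  using (_≡_; _≢_; refl; sym; trans; cong; subst; subst₂; module ≡-Reasoning)
open ≡-Reasoning

σ-isSOp : (n : ℕ) → IsSOp n (σ n)
σ-isSOp n = σ-S1 , σ-S2 n , σ-S3
  where
  σ-S1 : S1 n (σ n)
  σ-S1 zero    b c b+c≤n = z≤n , refl
  σ-S1 (suc a) b c b+c≤n = b+c≤n , refl

  σ-S2 : ∀ n → S2 n (σ n)
  σ-S2 zero    zero = refl
  σ-S2 (suc n) b    = refl

  σ-S3 : S3 n (σ n)
  σ-S3 zero    zero    _ = refl
  σ-S3 zero    (suc b) _ = refl
  σ-S3 (suc a) zero    _ = refl
  σ-S3 (suc a) (suc b) ()

module _ {n : ℕ} (_∘_ : C n → C n → C n) where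

  ∘-additive : S1 n _∘_ → ∀ a {b c x} → toℕ x ≡ toℕ b + toℕ c →
               toℕ (a ∘ x) ≡ toℕ (a ∘ b) + toℕ (a ∘ c)
  ∘-additive s1 a {b} {c} {x} x≡b+c = begin
    toℕ (a ∘ x)                      ≡⟨ cong (λ y → toℕ (a ∘ y)) x≡b⊕c ⟩
    toℕ (a ∘ ⊕ b c b+c≤n)            ≡⟨ cong toℕ (proj₂ (s1 a b c b+c≤n)) ⟩
    toℕ (⊕ (a ∘ b) (a ∘ c) ab+ac≤n)  ≡⟨ toℕ-fromℕ< _ ⟩
    toℕ (a ∘ b) + toℕ (a ∘ c)        ∎
    where
    b+c≤n : toℕ b + toℕ c ≤ n
    b+c≤n = subst (_≤ n) x≡b+c (toℕ≤pred[n] x)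

    ab+ac≤n : toℕ (a ∘ b) + toℕ (a ∘ c) ≤ n
    ab+ac≤n = proj₁ (s1 a b c b+c≤n)

    x≡b⊕c : x ≡ ⊕ b c b+c≤n
    x≡b⊕c = toℕ-injective (trans x≡b+c (sym (toℕ-fromℕ< _)))

  ∘-zeroʳ : S1 n _∘_ → ∀ a → a ∘ 𝟘 ≡ 𝟘
  ∘-zeroʳ s1 a = toℕ-injective (sym (+-cancelˡ-≡ t 0 t (trans (+-identityʳ t) t≡t+t)))
    where
    t : ℕ
    t = toℕ (a ∘ 𝟘)

    t≡t+t : t ≡ t + t
    t≡t+t = ∘-additive s1 a refl

  ∘-zeroˡ : S1 n _∘_ → S3 n _∘_ → ∀ b → 𝟘 ∘ b ≡ 𝟘
  ∘-zeroˡ s1 s3 b = trans (sym (s3 b 𝟘 (∘-zeroʳ s1 b))) (∘-zeroʳ s1 b)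

  ∘-𝟙≡𝟘⇒≡𝟘 : S2 n _∘_ → S3 n _∘_ → ∀ {a} → a ∘ 𝟙 ≡ 𝟘 → a ≡ 𝟘
  ∘-𝟙≡𝟘⇒≡𝟘 s2 s3 {a} a∘𝟙≡𝟘 = begin
    a      ≡⟨ sym (s2 a) ⟩
    𝟙 ∘ a  ≡⟨ sym (s3 a 𝟙 a∘𝟙≡𝟘) ⟩
    a ∘ 𝟙  ≡⟨ a∘𝟙≡𝟘 ⟩
    𝟘      ∎

atom : {m : ℕ} → C (suc m)
atom = suc zero

module _ {m : ℕ} (_∘_ : C (suc m) → C (suc m) → C (suc m)) where

  ∘-linear : S1 (suc m) _∘_ → ∀ a x → toℕ (a ∘ x) ≡ toℕ x * toℕ (a ∘ atom)
  ∘-linear s1 a = <-weakInduction P (cong toℕ (∘-zeroʳ _∘_ s1 a)) step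
    where
    k : ℕ
    k = toℕ (a ∘ atom)

    P : C (suc m) → Set
    P x = toℕ (a ∘ x) ≡ toℕ x * k

    step : ∀ i → P (inject₁ i) → P (suc i)
    step i ih = begin
      toℕ (a ∘ suc i)          ≡⟨ ∘-additive _∘_ s1 a suc-i≡i+1 ⟩
      toℕ (a ∘ inject₁ i) + k  ≡⟨ cong (_+ k) ih ⟩
      toℕ (inject₁ i) * k + k  ≡⟨ +-comm _ k ⟩
      k + toℕ (inject₁ i) * k  ≡⟨ cong (λ j → k + j * k) (toℕ-inject₁ i) ⟩
      suc (toℕ i) * k          ∎
      where
      suc-i≡i+1 : toℕ (suc i) ≡ toℕ (inject₁ i) + toℕ (atom {m})
      suc-i≡i+1 = trans (+-comm 1 (toℕ i)) (cong (_+ 1) (sym (toℕ-inject₁ i)))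

  toℕ-∘-𝟙 : S1 (suc m) _∘_ → ∀ a → toℕ (a ∘ 𝟙) ≡ suc m * toℕ (a ∘ atom)
  toℕ-∘-𝟙 s1 a = trans (∘-linear s1 a 𝟙) (cong (_* toℕ (a ∘ atom)) (toℕ-fromℕ (suc m)))

  ∘-atom≤1 : S1 (suc m) _∘_ → ∀ a → toℕ (a ∘ atom) ≤ 1
  ∘-atom≤1 s1 a = *-cancelˡ-≤ (suc m)
    (subst₂ _≤_ (toℕ-∘-𝟙 s1 a) (sym (*-identityʳ (suc m))) (toℕ≤pred[n] (a ∘ 𝟙)))

  ∘-atom≡1 : S1 (suc m) _∘_ → S2 (suc m) _∘_ → S3 (suc m) _∘_ →
             ∀ {a} → a ≢ 𝟘 → toℕ (a ∘ atom) ≡ 1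
  ∘-atom≡1 s1 s2 s3 {a} a≢𝟘 with n≤1⇒n≡0∨n≡1 (∘-atom≤1 s1 a)
  ... | inj₂ k≡1 = k≡1
  ... | inj₁ k≡0 = ⊥-elim (a≢𝟘 (∘-𝟙≡𝟘⇒≡𝟘 _∘_ s2 s3 a∘𝟙≡𝟘))
    where
    a∘𝟙≡𝟘 : a ∘ 𝟙 ≡ 𝟘
    a∘𝟙≡𝟘 = toℕ-injective (begin
      toℕ (a ∘ 𝟙)               ≡⟨ toℕ-∘-𝟙 s1 a ⟩
      suc m * toℕ (a ∘ atom)    ≡⟨ cong (suc m *_) k≡0 ⟩
      suc m * 0                 ≡⟨ *-zeroʳ (suc m) ⟩
      0                         ∎)

  ∘-identityˡ : S1 (suc m) _∘_ → S2 (suc m) _∘_ → S3 (suc m) _∘_ →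
                ∀ {a} → a ≢ 𝟘 → ∀ x → a ∘ x ≡ x
  ∘-identityˡ s1 s2 s3 {a} a≢𝟘 x = toℕ-injective (begin
    toℕ (a ∘ x)                ≡⟨ ∘-linear s1 a x ⟩
    toℕ x * toℕ (a ∘ atom)     ≡⟨ cong (toℕ x *_) (∘-atom≡1 s1 s2 s3 a≢𝟘) ⟩
    toℕ x * 1                  ≡⟨ *-identityʳ (toℕ x) ⟩
    toℕ x                      ∎)

σ-unique : ∀ {n} (_∘_ : C n → C n → C n) → IsSOp n _∘_ → ∀ a b → a ∘ b ≡ σ n a b
σ-unique         _∘_ (s1 , s2 , s3) zero    b = ∘-zeroˡ _∘_ s1 s3 b
σ-unique {suc m} _∘_ (s1 , s2 , s3) (suc a) b = ∘-identityˡ _∘_ s1 s2 s3 (λ ()) b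

proposition7p1 : (n : ℕ) → 1 ≤ n →
    IsSOp n (σ n) × ((o : C n → C n → C n) → IsSOp n o → (a b : C n) → o a b ≡ σ n a b)
proposition7p1 n _ = σ-isSOp n , σ-unique
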